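{- Let $A$ be a finite set of rational numbers, let $k\geq 1$ be an integer and let $A'\subseteq A$. Then $$E_k(A')^{1/k}\leq \Lambda_k(A)\,|A'|.$$ In particular $E_k(A)\leq \Lambda_k(A)^k|A|^k$.
   Context: $E_k(B)$ is the number of solutions of $b_1\cdots b_k=b_{k+1}\cdots b_{2k}$ with $b_1,\dots,b_{2k}\in B$. For a finite set $B=\{b_1,\dots,b_N\}$ and non-negative weights $w=(w_1,\dots,w_N)$, $E_{k,w}(B)=\sum w_{i_1}\cdots w_{i_{2k}}$ summing over all $2k$-tuples of indices with $b_{i_1}\cdots b_{i_k}=b_{i_{k+1}}\cdots b_{i_{2k}}$; $\Lambda_k(B)=\max_w E_{k,w}(B)^{1/k}$ over non-negative weights with $\sum_i w_i^2=1$. -}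

module Defs where

open import Data.Nat using (ℕ; zero; suc)
open import Data.List using (List; []; _∷_; map; concatMap; foldr; take; drop; filter; length; tabulate)
open import Data.Product using (_×_; _,_; proj₁; proj₂)
open import Data.Fin using (Fin)
open import Data.Rational using (ℚ; 0ℚ; 1ℚ; _+_; _*_)
open import Data.Rational.Properties using (_≟_)

prodℚ : List ℚ → ℚ
prodℚ = foldr _*_ 1ℚ

sumℚ : List ℚ → ℚ
sumℚ = foldr _+_ 0ℚ

_^ℚ_ : ℚ → ℕ → ℚ
q ^ℚ zero = 1ℚ
q ^ℚ suc n = q * (q ^ℚ n)

tuples : {X : Set} → ℕ → List X → List (List X)
tuples zero L = [] ∷ []
tuples (suc j) L = concatMap (λ x → map (x ∷_) (tuples j L)) L

-- E_k(B): number of 2k-tuples from B (a list of distinct rationals) solving the equation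
E : ℕ → List ℚ → ℕ
E k B = length (filter (λ t → prodℚ (take k t) ≟ prodℚ (drop k t)) (tuples (k Data.Nat.+ k) B))
  where import Data.Nat

Ew : ℕ → {n : ℕ} → (Fin n → ℚ) → (Fin n → ℚ) → ℚ
Ew k {n} b w =
  sumℚ (map (λ t → prodℚ (map w t))
            (filter (λ t → prodℚ (take k (map b t)) ≟ prodℚ (drop k (map b t)))
                    (tuples (k Data.Nat.+ k) (tabulate {n = n} (λ i → i)))))
  where import Data.Nat

sqNorm : {n : ℕ} → (Fin n → ℚ) → ℚ
sqNorm {n} w = sumℚ (tabulate {n = n} (λ i → w i * w i))

-- "M is an upper bound for Λ_k(b)^k", i.e. E_{k,w}(b) ≤ M for every non-negative w with Σ w_i² = 1.
-- Using homogeneity of degree 2k we state it for all non-negative rational w as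
-- E_{k,w}(b) ≤ M (Σ w_i²)^k.
open import Data.Rational using (_≤_)
IsΛkPowBound : ℕ → {n : ℕ} → (Fin n → ℚ) → ℚ → Set
IsΛkPowBound k {n} b M =
  (w : Fin n → ℚ) → (∀ i → 0ℚ ≤ w i) → Ew k b w ≤ M * (sqNorm w ^ℚ k)

ℕtoℚ : ℕ → ℚ
ℕtoℚ m = (Data.Integer.+ m) Data.Rational./ 1
  where import Data.Integer

{-# OPTIONS --safe #-}
-- Weight the index i by the multiplicity of A i in A' (the indicator of A', which is
-- duplicate-free).  Then ∑ᵢ wᵢ² = |A'|, and since the w-weighted image of the indices
-- under A is A', the weighted image of the 2k-tuples of indices is the set of 2k-tuples
-- from A'; hence E_{k,w}(A) = E_k(A'), and the bound on Λ_k(A)^k gives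
-- E_k(A') ≤ M |A'|^k.  The second claim is the case A' = A.
module Submission where

open import Defs
open import Data.Nat using (ℕ; _≥_)
open import Data.Fin using (Fin)
open import Data.List using (List; length; tabulate)
open import Data.List.Relation.Unary.All using (All)
open import Data.List.Relation.Unary.Unique.Propositional using (Unique)
open import Data.List.Membership.Propositional using (_∈_)
open import Data.Rational using (ℚ; _≤_; _*_)
open import Data.Product using (_×_)
open import Function.Definitions using (Injective)
open import Relation.Binary.PropositionalEquality using (_≡_)

open import Data.Nat as ℕ using (zero; suc)
import Data.Nat.Properties as ℕP
import Data.Nat.Coprimality as Coprimality
import Data.Integer.Properties as ℤP
open import Data.List using ([]; _∷_; map; filter; _++_; concatMap; take; drop; allFin)
import Data.List.Properties as ListP
import Data.Fin.Properties as FinP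
open import Data.List.Relation.Unary.All as All using ([]; _∷_)
open import Data.List.Relation.Unary.Any using (here; there)
open import Data.List.Relation.Unary.AllPairs using (_∷_)
import Data.List.Membership.Propositional.Properties as ∈P
import Data.List.Relation.Unary.Unique.Propositional.Properties as UniqueP
open import Data.Rational using (0ℚ; 1ℚ; _+_)
import Data.Rational.Properties as ℚP
open import Data.Product using (_,_)
open import Data.Empty using (⊥-elim)
open import Function using (id; _∘_; _⇔_; mk⇔; Equivalence)
open import Relation.Nullary using (Dec; yes; no; ¬_)
open import Relation.Binary.Definitions using (DecidableEquality)
open import Relation.Binary.PropositionalEquality
  using (refl; sym; trans; cong; cong₂; subst; subst₂; module ≡-Reasoning)
open import Algebra.Bundles using (CommutativeMonoid)
open import Algebra.Properties.CommutativeSemigroup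
  (CommutativeMonoid.commutativeSemigroup ℚP.+-0-commutativeMonoid) using (interchange)

open ≡-Reasoning

ℕtoℚ-suc : ∀ m → ℕtoℚ (suc m) ≡ 1ℚ + ℕtoℚ m
ℕtoℚ-suc m
  rewrite ℚP.normalize-coprime (Coprimality.sym (Coprimality.1-coprimeTo m))
        | ℕP.*-identityʳ m | ℤP.+◃n≡+n m = refl

iverson : ∀ {p} {P : Set p} → Dec P → ℚ
iverson (yes _) = 1ℚ
iverson (no _)  = 0ℚ

iverson-nonneg : ∀ {p} {P : Set p} (P? : Dec P) → 0ℚ ≤ iverson P?
iverson-nonneg (yes _) = ℚP.nonNegative⁻¹ 1ℚ
iverson-nonneg (no _)  = ℚP.≤-refl

iverson-cong : ∀ {p q} {P : Set p} {Q : Set q} → P ⇔ Q →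
               (P? : Dec P) (Q? : Dec Q) → iverson P? ≡ iverson Q?
iverson-cong P⇔Q (yes _) (yes _) = refl
iverson-cong P⇔Q (yes p) (no ¬q) = ⊥-elim (¬q (Equivalence.to P⇔Q p))
iverson-cong P⇔Q (no ¬p) (yes q) = ⊥-elim (¬p (Equivalence.from P⇔Q q))
iverson-cong P⇔Q (no _)  (no _)  = refl

private
  variable
    X Y : Set

∑ : (X → ℚ) → List X → ℚ
∑ f xs = sumℚ (map f xs)

∑-cong : {f g : X → ℚ} → (∀ x → f x ≡ g x) → ∀ xs → ∑ f xs ≡ ∑ g xs
∑-cong f≗g []       = refl
∑-cong f≗g (x ∷ xs) = cong₂ _+_ (f≗g x) (∑-cong f≗g xs)

∑-congᴬˡˡ : {f g : X → ℚ} {xs : List X} → All (λ x → f x ≡ g x) xs → ∑ f xs ≡ ∑ g xs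
∑-congᴬˡˡ []           = refl
∑-congᴬˡˡ (fx≡gx ∷ eqs) = cong₂ _+_ fx≡gx (∑-congᴬˡˡ eqs)

*-distribˡ-∑ : ∀ c (f : X → ℚ) xs → c * ∑ f xs ≡ ∑ (λ x → c * f x) xs
*-distribˡ-∑ c f []       = ℚP.*-zeroʳ c
*-distribˡ-∑ c f (x ∷ xs) =
  trans (ℚP.*-distribˡ-+ c (f x) (∑ f xs)) (cong (c * f x +_) (*-distribˡ-∑ c f xs))

∑-+ : ∀ (f g : X → ℚ) xs → ∑ (λ x → f x + g x) xs ≡ ∑ f xs + ∑ g xs
∑-+ f g []       = refl
∑-+ f g (x ∷ xs) =
  trans (cong (f x + g x +_) (∑-+ f g xs)) (interchange (f x) (g x) (∑ f xs) (∑ g xs))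

∑-nonneg : ∀ {f : X → ℚ} → (∀ x → 0ℚ ≤ f x) → ∀ xs → 0ℚ ≤ ∑ f xs
∑-nonneg f≥0 []       = ℚP.≤-refl
∑-nonneg f≥0 (x ∷ xs) = ℚP.+-mono-≤ (f≥0 x) (∑-nonneg f≥0 xs)

∑-++ : ∀ (f : X → ℚ) xs ys → ∑ f (xs ++ ys) ≡ ∑ f xs + ∑ f ys
∑-++ f []       ys = sym (ℚP.+-identityˡ (∑ f ys))
∑-++ f (x ∷ xs) ys = trans (cong (f x +_) (∑-++ f xs ys)) (sym (ℚP.+-assoc (f x) _ _))

∑-concatMap : ∀ (f : Y → ℚ) (g : X → List Y) xs →
              ∑ f (concatMap g xs) ≡ ∑ (λ x → ∑ f (g x)) xs
∑-concatMap f g []       = refl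
∑-concatMap f g (x ∷ xs) =
  trans (∑-++ f (g x) (concatMap g xs)) (cong (∑ f (g x) +_) (∑-concatMap f g xs))

∑-filter : ∀ {p} {P : X → Set p} (P? : ∀ x → Dec (P x)) (f : X → ℚ) xs →
           ∑ f (filter P? xs) ≡ ∑ (λ x → f x * iverson (P? x)) xs
∑-filter P? f []       = refl
∑-filter P? f (x ∷ xs) with P? x
... | yes _ = cong₂ _+_ (sym (ℚP.*-identityʳ (f x))) (∑-filter P? f xs)
... | no _  = begin
  ∑ f (filter P? xs)                           ≡⟨ ∑-filter P? f xs ⟩
  ∑ (λ x → f x * iverson (P? x)) xs            ≡⟨ ℚP.+-identityˡ _ ⟨
  0ℚ + ∑ (λ x → f x * iverson (P? x)) xs       ≡⟨ cong (_+ _) (ℚP.*-zeroʳ (f x)) ⟨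
  f x * 0ℚ + ∑ (λ x → f x * iverson (P? x)) xs ∎

∑-one : ∀ (xs : List X) → ∑ (λ _ → 1ℚ) xs ≡ ℕtoℚ (length xs)
∑-one []       = refl
∑-one (x ∷ xs) = trans (cong (1ℚ +_) (∑-one xs)) (sym (ℕtoℚ-suc (length xs)))

∑-tuples-suc : ∀ (f : List X → ℚ) m xs →
               ∑ f (tuples (suc m) xs) ≡ ∑ (λ x → ∑ (f ∘ (x ∷_)) (tuples m xs)) xs
∑-tuples-suc f m xs = trans (∑-concatMap f _ xs)
  (∑-cong (λ x → cong sumℚ (sym (ListP.map-∘ (tuples m xs)))) xs)

-- The measure ∑ₓ w x · δ (f x) on Y is the counting measure of ys.
IsWeightedImage : (X → Y) → (X → ℚ) → List X → List Y → Set
IsWeightedImage f w xs ys = ∀ (h : _ → ℚ) → ∑ (λ x → w x * h (f x)) xs ≡ ∑ h ys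

tuples-weightedImage : ∀ {f : X → Y} {w xs ys} → IsWeightedImage f w xs ys → ∀ m →
  IsWeightedImage (map f) (prodℚ ∘ map w) (tuples m xs) (tuples m ys)
tuples-weightedImage img zero h = cong (_+ 0ℚ) (ℚP.*-identityˡ (h []))
tuples-weightedImage {f = f} {w} {xs} {ys} img (suc m) h = begin
  ∑ (λ t → prodℚ (map w t) * h (map f t)) (tuples (suc m) xs)
    ≡⟨ ∑-tuples-suc _ m xs ⟩
  ∑ (λ x → ∑ (λ t → (w x * prodℚ (map w t)) * h (f x ∷ map f t)) (tuples m xs)) xs
    ≡⟨ ∑-cong (λ x → trans (∑-cong (λ t → ℚP.*-assoc (w x) _ _) (tuples m xs))
                            (sym (*-distribˡ-∑ (w x) _ (tuples m xs)))) xs ⟩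
  ∑ (λ x → w x * ∑ (λ t → prodℚ (map w t) * h (f x ∷ map f t)) (tuples m xs)) xs
    ≡⟨ ∑-cong (λ x → cong (w x *_) (tuples-weightedImage img m (h ∘ (f x ∷_)))) xs ⟩
  ∑ (λ x → w x * ∑ (h ∘ (f x ∷_)) (tuples m ys)) xs
    ≡⟨ img (λ y → ∑ (h ∘ (y ∷_)) (tuples m ys)) ⟩
  ∑ (λ y → ∑ (h ∘ (y ∷_)) (tuples m ys)) ys
    ≡⟨ ∑-tuples-suc h m ys ⟨
  ∑ h (tuples (suc m) ys) ∎

∑-δ-∉ : (_≟_ : DecidableEquality X) (f : X → ℚ) {j : X} {xs : List X} →
        ¬ j ∈ xs → ∑ (λ i → iverson (i ≟ j) * f i) xs ≡ 0ℚ
∑-δ-∉ _≟_ f {j} {[]}     j∉ = refl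
∑-δ-∉ _≟_ f {j} {x ∷ xs} j∉ with x ≟ j
... | yes refl = ⊥-elim (j∉ (here refl))
... | no _     =
  trans (cong₂ _+_ (ℚP.*-zeroˡ (f x)) (∑-δ-∉ _≟_ f (j∉ ∘ there))) (ℚP.+-identityˡ 0ℚ)

∑-δ : (_≟_ : DecidableEquality X) (f : X → ℚ) {j : X} {xs : List X} →
      Unique xs → j ∈ xs → ∑ (λ i → iverson (i ≟ j) * f i) xs ≡ f j
∑-δ _≟_ f {j} {x ∷ xs} (x∉xs ∷ _) (here refl) with x ≟ x
... | no x≢x = ⊥-elim (x≢x refl)
... | yes _  = begin
  1ℚ * f x + ∑ (λ i → iverson (i ≟ x) * f i) xs ≡⟨ cong₂ _+_ (ℚP.*-identityˡ (f x)) (∑-δ-∉ _≟_ f x∉) ⟩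
  f x + 0ℚ                                      ≡⟨ ℚP.+-identityʳ (f x) ⟩
  f x                                           ∎
  where x∉ = λ x∈xs → All.lookup x∉xs x∈xs refl
∑-δ _≟_ f {j} {x ∷ xs} (x∉xs ∷ u) (there j∈xs) with x ≟ j
... | yes refl = ⊥-elim (All.lookup x∉xs j∈xs refl)
... | no _     = trans (cong₂ _+_ (ℚP.*-zeroˡ (f x)) (∑-δ _≟_ f u j∈xs)) (ℚP.+-identityˡ (f j))

module _ {X : Set} (_≟_ : DecidableEquality X) where

  multiplicity : List X → X → ℚ
  multiplicity ys y = ∑ (λ a → iverson (a ≟ y)) ys

  multiplicity-nonneg : ∀ ys y → 0ℚ ≤ multiplicity ys y
  multiplicity-nonneg ys y = ∑-nonneg (λ a → iverson-nonneg (a ≟ y)) ys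

  multiplicity-unique : ∀ {ys y} → Unique ys → y ∈ ys → multiplicity ys y ≡ 1ℚ
  multiplicity-unique {ys} {y} u y∈ys =
    trans (∑-cong (λ a → sym (ℚP.*-identityʳ (iverson (a ≟ y)))) ys) (∑-δ _≟_ (λ _ → 1ℚ) u y∈ys)

  multiplicity-weightedImage : ∀ {n} {f : Fin n → X} → Injective _≡_ _≡_ f →
    ∀ {ys} → All (_∈ tabulate f) ys → IsWeightedImage f (multiplicity ys ∘ f) (allFin n) ys
  multiplicity-weightedImage {n} {f} inj {[]} [] h =
    trans (sym (*-distribˡ-∑ 0ℚ (h ∘ f) (allFin n))) (ℚP.*-zeroˡ (∑ (h ∘ f) (allFin n)))
  multiplicity-weightedImage {n} {f} inj {y ∷ ys} (y∈f ∷ ys⊆f) h with ∈P.∈-tabulate⁻ y∈f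
  ... | j , refl = begin
    ∑ (λ i → (iverson (f j ≟ f i) + multiplicity ys (f i)) * h (f i)) (allFin n)
      ≡⟨ ∑-cong (λ i → ℚP.*-distribʳ-+ (h (f i)) (iverson (f j ≟ f i)) (multiplicity ys (f i)))
                (allFin n) ⟩
    ∑ (λ i → iverson (f j ≟ f i) * h (f i) + multiplicity ys (f i) * h (f i)) (allFin n)
      ≡⟨ ∑-+ _ _ (allFin n) ⟩
    ∑ (λ i → iverson (f j ≟ f i) * h (f i)) (allFin n)
      + ∑ (λ i → multiplicity ys (f i) * h (f i)) (allFin n)
      ≡⟨ cong₂ _+_ δ-term (multiplicity-weightedImage inj ys⊆f h) ⟩
    h (f j) + ∑ h ys ∎
    where
    fj≡fi⇔i≡j : ∀ {i} → f j ≡ f i ⇔ i ≡ j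
    fj≡fi⇔i≡j = mk⇔ (sym ∘ inj) (cong f ∘ sym)

    δ-term : ∑ (λ i → iverson (f j ≟ f i) * h (f i)) (allFin n) ≡ h (f j)
    δ-term = begin
      ∑ (λ i → iverson (f j ≟ f i) * h (f i)) (allFin n)
        ≡⟨ ∑-cong (λ i → cong (_* h (f i)) (iverson-cong fj≡fi⇔i≡j (f j ≟ f i) (i FinP.≟ j))) (allFin n) ⟩
      ∑ (λ i → iverson (i FinP.≟ j) * h (f i)) (allFin n)
        ≡⟨ ∑-δ FinP._≟_ (h ∘ f) (UniqueP.allFin⁺ n) (∈P.∈-allFin j) ⟩
      h (f j) ∎

balanced? : ∀ k (s : List ℚ) → Dec (prodℚ (take k s) ≡ prodℚ (drop k s))
balanced? k s = prodℚ (take k s) ℚP.≟ prodℚ (drop k s)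

E-as-∑ : ∀ k B → ℕtoℚ (E k B) ≡ ∑ (iverson ∘ balanced? k) (tuples (k ℕ.+ k) B)
E-as-∑ k B = begin
  ℕtoℚ (E k B)                            ≡⟨ ∑-one (filter (balanced? k) T) ⟨
  ∑ (λ _ → 1ℚ) (filter (balanced? k) T)    ≡⟨ ∑-filter (balanced? k) (λ _ → 1ℚ) T ⟩
  ∑ (λ s → 1ℚ * iverson (balanced? k s)) T ≡⟨ ∑-cong (λ s → ℚP.*-identityˡ _) T ⟩
  ∑ (iverson ∘ balanced? k) T              ∎
  where T = tuples (k ℕ.+ k) B

Ew-as-∑ : ∀ k {n} (b w : Fin n → ℚ) →
  Ew k b w ≡ ∑ (λ t → prodℚ (map w t) * iverson (balanced? k (map b t)))
               (tuples (k ℕ.+ k) (allFin n))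
Ew-as-∑ k {n} b w =
  ∑-filter (balanced? k ∘ map b) (prodℚ ∘ map w) (tuples (k ℕ.+ k) (allFin n))

module _ {n} {A : Fin n → ℚ} (inj : Injective _≡_ _≡_ A)
         {L : List ℚ} (L⊆A : All (_∈ tabulate A) L) where

  private
    w : Fin n → ℚ
    w = multiplicity ℚP._≟_ L ∘ A

    L-image : IsWeightedImage A w (allFin n) L
    L-image = multiplicity-weightedImage ℚP._≟_ inj L⊆A

  Ew-multiplicity : ∀ k → Ew k A w ≡ ℕtoℚ (E k L)
  Ew-multiplicity k = begin
    Ew k A w
      ≡⟨ Ew-as-∑ k A w ⟩
    ∑ (λ t → prodℚ (map w t) * iverson (balanced? k (map A t))) (tuples (k ℕ.+ k) (allFin n))
      ≡⟨ tuples-weightedImage L-image (k ℕ.+ k) (iverson ∘ balanced? k) ⟩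
    ∑ (iverson ∘ balanced? k) (tuples (k ℕ.+ k) L)
      ≡⟨ E-as-∑ k L ⟨
    ℕtoℚ (E k L) ∎

  sqNorm-multiplicity : Unique L → sqNorm w ≡ ℕtoℚ (length L)
  sqNorm-multiplicity u = begin
    sqNorm w
      ≡⟨ cong sumℚ (ListP.map-tabulate id (λ i → w i * w i)) ⟨
    ∑ (λ i → w i * multiplicity ℚP._≟_ L (A i)) (allFin n)
      ≡⟨ L-image (multiplicity ℚP._≟_ L) ⟩
    ∑ (multiplicity ℚP._≟_ L) L
      ≡⟨ ∑-congᴬˡˡ (All.tabulate (multiplicity-unique ℚP._≟_ u)) ⟩
    ∑ (λ _ → 1ℚ) L
      ≡⟨ ∑-one L ⟩
    ℕtoℚ (length L) ∎

  E-≤-ΛkPowBound : ∀ k → Unique L → ∀ M → IsΛkPowBound k A M →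
                   ℕtoℚ (E k L) ≤ M * (ℕtoℚ (length L) ^ℚ k)
  E-≤-ΛkPowBound k u M bound =
    subst₂ _≤_ (Ew-multiplicity k) (cong (λ N → M * (N ^ℚ k)) (sqNorm-multiplicity u))
      (bound w (λ i → multiplicity-nonneg ℚP._≟_ L (A i)))

corollary9 : (n : ℕ) (A : Fin n → ℚ) → Injective _≡_ _≡_ A →
    (k : ℕ) → k ≥ 1 →
    (A' : List ℚ) → Unique A' → All (λ x → x ∈ tabulate A) A' →
    (M : ℚ) → IsΛkPowBound k A M →
    (ℕtoℚ (E k A') ≤ M * (ℕtoℚ (length A') ^ℚ k))
      × (ℕtoℚ (E k (tabulate A)) ≤ M * (ℕtoℚ n ^ℚ k))
-- The argument is uniform in k.
corollary9 n A inj k _ A' A'-unique A'⊆A M bound =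
  E-≤-ΛkPowBound inj A'⊆A k A'-unique M bound ,
  subst (λ m → ℕtoℚ (E k (tabulate A)) ≤ M * (ℕtoℚ m ^ℚ k)) (ListP.length-tabulate A)
    (E-≤-ΛkPowBound inj (All.tabulate id) k (UniqueP.tabulate⁺ inj) M bound)
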